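{- Let $X,Y$ be NUTS and $t\in\mathbf{NUTS}(X,Y)$. Then $!t\in\mathbf{NUTS}(!X,!Y)$, where $!t=\{([a_1,\dots,a_n],[b_1,\dots,b_n])\mid n\in\mathbb N,\ (a_i,b_i)\in t\text{ for all }i\}$.
   Context: $\mathcal M_{\mathrm{fin}}(E)$ is the set of finite multisets on $E$, written $[a_1,\dots,a_n]$. For $\mathcal T\subseteq\mathcal P(E)$, $\mathcal T^\perp=\{u'\subseteq E\mid\forall u\in\mathcal T,\ u\cap u'\neq\emptyset\}$. A NUTS is $X=(|X|,\mathcal T(X))$ with $\mathcal T(X)\subseteq\mathcal P(|X|)$ and $\mathcal T(X)=\mathcal T(X)^{\perp\perp}$; $X^\perp=(|X|,\mathcal T(X)^\perp)$, $X\otimes Y=(|X|\times|Y|,\{u\times v\mid u\in\mathcal T(X),v\in\mathcal T(Y)\}^{\perp\perp})$, $X\multimap Y=(X\otimes Y^\perp)^\perp$, $\mathbf{NUTS}(X,Y)=\mathcal T(X\multimap Y)$. $!X=(\mathcal M_{\mathrm{fin}}(|X|),\{\mathcal M_{\mathrm{fin}}(u)\mid u\in\mathcal T(X)\}^{\perp\perp})$. -}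

module Defs where

open import Level using (0ℓ)
open import Data.Product using (Σ; ∃; ∃₂; _×_; _,_; proj₁; proj₂)
open import Data.List using (List; map)
open import Data.List.Relation.Unary.All using (All)
open import Data.List.Relation.Binary.Permutation.Propositional
  using (_↭_; ↭-setoid; ↭-trans; ↭-sym)
open import Data.List.Relation.Binary.Permutation.Propositional.Properties
  using (All-resp-↭)
open import Data.Product.Relation.Binary.Pointwise.NonDependent using (×-setoid)
open import Relation.Binary.Bundles using (Setoid)
import Relation.Binary.PropositionalEquality as ≡

-- For plain webs the equivalence is ≡ (any predicate);
-- for M_fin(E) the web is List E up to permutation ↭ (no quotients in
-- Agda), so subsets of M_fin(E) are exactly ↭-invariant predicates.
record Sub (S : Setoid 0ℓ 0ℓ) : Set₁ where
  open Setoid S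
  field
    mem  : Carrier → Set
    resp : ∀ {x y} → x ≈ y → mem x → mem y
open Sub public

Fam : Setoid 0ℓ 0ℓ → Set₂
Fam S = Sub S → Set₁

_≐_ : ∀ {S} → Sub S → Sub S → Set
_≐_ {S} u v = ∀ x → (mem u x → mem v x) × (mem v x → mem u x)

Meets : ∀ {S} → Sub S → Sub S → Set
Meets {S} u u' = ∃ λ (x : Setoid.Carrier S) → mem u x × mem u' x

_⊥ : ∀ {S} → Fam S → Fam S
(T ⊥) u' = ∀ u → T u → Meets u u'

_⇔₁_ : Set₁ → Set₁ → Set₁
A ⇔₁ B = (A → B) × (B → A)

record NUTS : Set₂ where
  field
    web    : Set
    T      : Fam (≡.setoid web)
    closed : ∀ u → T u ⇔₁ ((T ⊥) ⊥) u
open NUTS public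

prodSub : ∀ {S S'} → Sub S → Sub S' → Sub (×-setoid S S')
prodSub u v = record
  { mem  = λ p → mem u (proj₁ p) × mem v (proj₂ p)
  ; resp = λ { (e₁ , e₂) (a , b) → resp u e₁ a , resp v e₂ b } }

tensorF : ∀ {S S'} → Fam S → Fam S' → Fam (×-setoid S S')
tensorF TX TY = ((λ w → ∃₂ λ u v → TX u × TY v × (w ≐ prodSub u v)) ⊥) ⊥

lolliF : ∀ {S S'} → Fam S → Fam S' → Fam (×-setoid S S')
lolliF TX TY = (tensorF TX (TY ⊥)) ⊥

Mfin : ∀ {E : Set} → Sub (≡.setoid E) → Sub (↭-setoid {A = E})
Mfin u = record { mem = All (mem u) ; resp = All-resp-↭ }

bangF : (X : NUTS) → Fam (↭-setoid {A = web X})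
bangF X = ((λ w → ∃ λ u → T X u × (w ≐ Mfin u)) ⊥) ⊥

bangRel : ∀ {A B : Set} → Sub (×-setoid (≡.setoid A) (≡.setoid B))
        → Sub (×-setoid (↭-setoid {A = A}) (↭-setoid {A = B}))
bangRel t = record
  { mem  = λ p → ∃ λ ps → All (mem t) ps
                 × (map proj₁ ps ↭ proj₁ p) × (map proj₂ ps ↭ proj₂ p)
  ; resp = λ { (e₁ , e₂) (ps , a , p₁ , p₂) → ps , a , ↭-trans p₁ e₁ , ↭-trans p₂ e₂ } }

NUTSHom : (X Y : NUTS) → Sub (×-setoid (≡.setoid (web X)) (≡.setoid (web Y))) → Set₁
NUTSHom X Y t = lolliF (T X) (T Y) t

-- A morphism t ∈ NUTS(X,Y) sends every u ∈ T(X) to its image t·u ∈ T(Y).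
-- To see that !t ∈ T(!X ⊗ !Y^⊥)^⊥ it suffices, since T(!X) is generated by
-- the M_fin(u), that the preimage under !t of each V ∈ T(!Y)^⊥ meets every
-- M_fin(u).  Now V meets M_fin(t·u) ∈ T(!Y) in some [b₁,…,bₙ] with bᵢ ∈ t·u;
-- choosing aᵢ ∈ u with (aᵢ,bᵢ) ∈ t gives [a₁,…,aₙ] ∈ M_fin(u) ∩ (!t)⁻¹(V).
module Submission where

open import Defs
open import Relation.Binary.PropositionalEquality using (setoid)
open import Data.Product.Relation.Binary.Pointwise.NonDependent using (×-setoid)
open import Level using (0ℓ)
open import Data.Product using (∃; ∃₂; _×_; _,_; proj₂)
open import Data.List using (List; []; _∷_)
open import Data.List.Relation.Unary.All using (All; []; _∷_)
open import Data.List.Relation.Binary.Permutation.Propositional using (↭-refl; ↭-setoid; prep)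
open import Relation.Binary.Bundles using (Setoid)

private
  variable
    S S' : Setoid 0ℓ 0ℓ

Meets-sym : {u v : Sub S} → Meets u v → Meets v u
Meets-sym (x , x∈u , x∈v) = x , x∈v , x∈u

Meets-≐ˡ : {u w v : Sub S} → w ≐ u → Meets u v → Meets w v
Meets-≐ˡ w≐u (x , x∈u , x∈v) = x , proj₂ (w≐u x) x∈u , x∈v

≐-refl : (u : Sub S) → u ≐ u
≐-refl u x = (λ x∈u → x∈u) , (λ x∈u → x∈u)

⊥⊥-intro : (T : Fam S) (u : Sub S) → T u → (T ⊥ ⊥) u
⊥⊥-intro T u Tu v T⊥v = Meets-sym {u = u} {v = v} (T⊥v u Tu)

products : Fam S → Fam S' → Fam (×-setoid S S')
products TX TY w = ∃₂ λ u v → TX u × TY v × (w ≐ prodSub u v)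

Mfins : (X : NUTS) → Fam (↭-setoid {A = web X})
Mfins X w = ∃ λ u → T X u × (w ≐ Mfin u)

prodSub-∈tensorF : (TX : Fam S) (TY : Fam S') (u : Sub S) (v : Sub S')
                 → TX u → TY v → tensorF TX TY (prodSub u v)
prodSub-∈tensorF TX TY u v TXu TYv =
  ⊥⊥-intro (products TX TY) (prodSub u v) (u , v , TXu , TYv , ≐-refl (prodSub u v))

Mfin-∈bangF : (X : NUTS) (u : Sub (setoid (web X))) → T X u → bangF X (Mfin u)
Mfin-∈bangF X u TXu =
  ⊥⊥-intro (Mfins X) (Mfin u) (u , TXu , ≐-refl (Mfin u))

image : Sub (×-setoid S S') → Sub S → Sub S'
image {S = S} t u = record
  { mem  = λ b → ∃ λ a → mem u a × mem t (a , b)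
  ; resp = λ b≈b′ (a , a∈u , ab∈t) → a , a∈u , resp t (Setoid.refl S , b≈b′) ab∈t }

preimage : Sub (×-setoid S S') → Sub S' → Sub S
preimage {S' = S'} t v = record
  { mem  = λ a → ∃ λ b → mem v b × mem t (a , b)
  ; resp = λ a≈a′ (b , b∈v , ab∈t) → b , b∈v , resp t (a≈a′ , Setoid.refl S') ab∈t }

lolli-image : (TX : Fam S) (TY : Fam S') (t : Sub (×-setoid S S')) {u : Sub S}
            → lolliF TX TY t → TX u → (TY ⊥ ⊥) (image t u)
lolli-image TX TY t {u} t∈⊸ TXu v TY⊥v
  with t∈⊸ (prodSub u v) (prodSub-∈tensorF TX (TY ⊥) u v TXu TY⊥v)
... | (a , b) , (a∈u , b∈v) , ab∈t = b , b∈v , (a , a∈u , ab∈t)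

lolli-of-preimage : (G : Fam S) (TY : Fam S') (t : Sub (×-setoid S S'))
                  → (∀ v → (TY ⊥) v → (G ⊥) (preimage t v))
                  → lolliF (G ⊥ ⊥) TY t
lolli-of-preimage {S = S} {S' = S'} G TY t preimage⊥ w w∈⊗ =
  Meets-sym {u = t} {v = w} (w∈⊗ t λ g (U , v , U∈G⊥⊥ , v∈TY⊥ , g≐U×v) →
    Meets-≐ˡ {u = prodSub U v} {w = g} {v = t} g≐U×v
      (meets-product U v (U∈G⊥⊥ (preimage t v) (preimage⊥ v v∈TY⊥))))
  where
  meets-product : (U : Sub S) (v : Sub S') → Meets (preimage t v) U → Meets (prodSub U v) t
  meets-product U v (a , (b , b∈v , ab∈t) , a∈U) = (a , b) , (a∈U , b∈v) , ab∈t

All-image⇒bangRel : {A B : Set} (t : Sub (×-setoid (setoid A) (setoid B))) (u : Sub (setoid A))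
                  → {bs : List B} → All (mem (image t u)) bs
                  → ∃ λ as → All (mem u) as × mem (bangRel t) (as , bs)
All-image⇒bangRel t u [] = [] , [] , [] , [] , ↭-refl , ↭-refl
All-image⇒bangRel t u {b ∷ _} ((a , a∈u , ab∈t) ∷ bs∈image)
  with All-image⇒bangRel t u bs∈image
... | as , as∈u , ps , ps∈t , ↭as , ↭bs =
  a ∷ as , a∈u ∷ as∈u , (a , b) ∷ ps , ab∈t ∷ ps∈t , prep a ↭as , prep b ↭bs

lemma4p9 : (X Y : NUTS) (t : Sub (×-setoid (setoid (web X)) (setoid (web Y))))
    → NUTSHom X Y t → lolliF (bangF X) (bangF Y) (bangRel t)
lemma4p9 X Y t t∈hom =
  lolli-of-preimage (Mfins X) (bangF Y) (bangRel t) preimage-meets-Mfin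
  where
  image-∈T : ∀ {u} → T X u → T Y (image t u)
  image-∈T {u} TXu = proj₂ (closed Y (image t u)) (lolli-image (T X) (T Y) t t∈hom TXu)

  preimage-meets-Mfin : ∀ V → (bangF Y ⊥) V
                      → (Mfins X ⊥) (preimage (bangRel t) V)
  preimage-meets-Mfin V V∈!Y⊥ g (u , TXu , g≐Mfin-u) =
    let (bs , bs∈tu , bs∈V) = V∈!Y⊥ (Mfin (image t u)) (Mfin-∈bangF Y (image t u) (image-∈T TXu))
        (as , as∈u , as!tbs) = All-image⇒bangRel t u bs∈tu
    in as , proj₂ (g≐Mfin-u as) as∈u , (bs , bs∈V , as!tbs)
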